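{- For every natural number $n$ there is a property of words (a class of finite words over a fixed finite alphabet, closed under isomorphism) that is expressible by a sentence of $\mathrm{FO}[2,2^n+2]$ but is not expressible by any sentence of $\mathrm{FO}[k,n]$, for any $k\ge 1$.
   Context: A word (string) of length $m$ over an alphabet of $r$ symbols is regarded as a finite structure with universe $\{0,\dots,m-1\}$ over the vocabulary $\{<,R_1,\dots,R_r\}$, where $<$ is the usual ordering of positions and the unary relation $R_i$ holds exactly at the positions carrying the $i$-th symbol. For $k\ge 1$ and $q\ge 0$, $\mathrm{FO}[k,q]$ is the set of first-order formulas of quantifier rank at most $q$ using at most $k$ distinct variables (free and bound). A property (class of words) is expressible by a sentence $\varphi$ if a word belongs to the class iff it satisfies $\varphi$. -}

module Defs where

open import Data.Nat using (ℕ; zero; suc; _<_; _≤_; _⊔_; _+_)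
open import Data.Fin using (Fin; fromℕ<)
open import Data.Fin.Properties using () renaming (_≟_ to _≟ᶠ_)
open import Data.List using (List; length; lookup)
open import Data.Product using (Σ; _×_)
open import Data.Sum using (_⊎_)
open import Data.Empty using (⊥)
open import Relation.Nullary using (¬_; yes; no)
open import Relation.Binary.PropositionalEquality using (_≡_)

-- Words over the alphabet Fin r: a word of length m is a list of m letters,
-- regarded as the structure with universe {0,…,m-1}, the order <, and
-- unary relations R_i (i : Fin r).
Word : ℕ → Set
Word r = List (Fin r)

data Formula (r k : ℕ) : Set where
  _≐_  : Fin k → Fin k → Formula r k
  _≺_  : Fin k → Fin k → Formula r k
  Rel  : Fin r → Fin k → Formula r k
  ¬ᶠ_  : Formula r k → Formula r k
  _∧ᶠ_ : Formula r k → Formula r k → Formula r k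
  _∨ᶠ_ : Formula r k → Formula r k → Formula r k
  ∃ᶠ   : Fin k → Formula r k → Formula r k
  ∀ᶠ   : Fin k → Formula r k → Formula r k

qr : ∀ {r k} → Formula r k → ℕ
qr (x ≐ y)   = 0
qr (x ≺ y)   = 0
qr (Rel i x) = 0
qr (¬ᶠ φ)    = qr φ
qr (φ ∧ᶠ ψ)  = qr φ ⊔ qr ψ
qr (φ ∨ᶠ ψ)  = qr φ ⊔ qr ψ
qr (∃ᶠ x φ)  = suc (qr φ)
qr (∀ᶠ x φ)  = suc (qr φ)

data FreeIn {r k : ℕ} (z : Fin k) : Formula r k → Set where
  f≐ˡ : ∀ {y} → FreeIn z (z ≐ y)
  f≐ʳ : ∀ {x} → FreeIn z (x ≐ z)
  f≺ˡ : ∀ {y} → FreeIn z (z ≺ y)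
  f≺ʳ : ∀ {x} → FreeIn z (x ≺ z)
  fR  : ∀ {i} → FreeIn z (Rel i z)
  f¬  : ∀ {φ} → FreeIn z φ → FreeIn z (¬ᶠ φ)
  f∧ˡ : ∀ {φ ψ} → FreeIn z φ → FreeIn z (φ ∧ᶠ ψ)
  f∧ʳ : ∀ {φ ψ} → FreeIn z ψ → FreeIn z (φ ∧ᶠ ψ)
  f∨ˡ : ∀ {φ ψ} → FreeIn z φ → FreeIn z (φ ∨ᶠ ψ)
  f∨ʳ : ∀ {φ ψ} → FreeIn z ψ → FreeIn z (φ ∨ᶠ ψ)
  f∃  : ∀ {x φ} → ¬ (x ≡ z) → FreeIn z φ → FreeIn z (∃ᶠ x φ)
  f∀  : ∀ {x φ} → ¬ (x ≡ z) → FreeIn z φ → FreeIn z (∀ᶠ x φ)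

Sentence : ∀ {r k} → Formula r k → Set
Sentence {k = k} φ = (z : Fin k) → ¬ FreeIn z φ

FOSentence : (r k q : ℕ) → Formula r k → Set
FOSentence r k q φ = Sentence φ × qr φ ≤ q

-- assignments send variables to natural numbers (meaningful when < length w)
Assignment : ℕ → Set
Assignment k = Fin k → ℕ

_[_↦_] : ∀ {k} → Assignment k → Fin k → ℕ → Assignment k
(α [ x ↦ p ]) y with x ≟ᶠ y
... | yes _ = p
... | no  _ = α y

HasLetter : ∀ {r} → Word r → ℕ → Fin r → Set
HasLetter w p i = Σ (p < length w) (λ h → lookup w (fromℕ< h) ≡ i)

Sat : ∀ {r k} → (w : Word r) → Assignment k → Formula r k → Set
Sat w α (x ≐ y)   = α x ≡ α y
Sat w α (x ≺ y)   = α x < α y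
Sat w α (Rel i x) = HasLetter w (α x) i
Sat w α (¬ᶠ φ)    = ¬ Sat w α φ
Sat w α (φ ∧ᶠ ψ)  = Sat w α φ × Sat w α ψ
Sat w α (φ ∨ᶠ ψ)  = Sat w α φ ⊎ Sat w α ψ
Sat w α (∃ᶠ x φ)  = Σ ℕ (λ p → p < length w × Sat w (α [ x ↦ p ]) φ)
Sat w α (∀ᶠ x φ)  = (p : ℕ) → p < length w → Sat w (α [ x ↦ p ]) φ

-- truth of a sentence in a word (assignment irrelevant for sentences)
_⊨_ : ∀ {r k} → Word r → Formula r k → Set
w ⊨ φ = Sat w (λ _ → 0) φ

Expresses : ∀ {r k} → Formula r k → (Word r → Set) → Set
Expresses {r} φ P = (w : Word r) → (P w → w ⊨ φ) × (w ⊨ φ → P w)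

ExpressibleIn : (r k q : ℕ) → (Word r → Set) → Set
ExpressibleIn r k q P = Σ (Formula r k) (λ φ → FOSentence r k q φ × Expresses φ P)

-- Alternating two variables, the formula "some position has 2 ^ n positions
-- below it" has rank 2 ^ n + 1 and says that the word is longer than 2 ^ n.
-- Over a one-letter alphabet a word is just a linear order, and words of
-- lengths 2 ^ n and 2 ^ n + 1 agree on all sentences of rank n, with any
-- number of variables: Duplicator keeps every gap between two pebbles or
-- end markers either equal in both words or at least 2 ^ (rounds left) in
-- both, and a new pebble can always be placed so that this survives with the
-- threshold halved.
module Submission where

open import Defs
open import Data.Nat using (ℕ; zero; suc; _^_; _+_; _*_; _≤_; _<_; _≤?_; z≤n; s≤s)
open import Data.Nat.Properties
open import Data.Nat.Tactic.RingSolver using (solve-∀)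
open import Data.Fin using (Fin; zero; suc)
open import Data.Fin.Properties using () renaming (_≟_ to _≟ᶠ_)
open import Data.List using (List; _∷_; length; map; filter; replicate; allFin)
open import Data.List.Properties using (length-replicate)
open import Data.List.Extrema.Nat
  using (argmax; argmin; argmax-all; argmin-all; f[xs]≤f[argmax]; f[argmin]≤f[xs])
open import Data.List.Membership.Propositional using (_∈_)
open import Data.List.Membership.Propositional.Properties using (∈-filter⁺; ∈-map⁺; ∈-allFin)
open import Data.List.Relation.Unary.All using (lookup)
open import Data.List.Relation.Unary.All.Properties using (all-filter)
open import Data.List.Relation.Unary.Any using (here; there)
open import Data.Maybe using (Maybe; nothing; just)
open import Data.Product using (Σ; _×_; _,_; proj₁; proj₂; ∃-syntax)
open import Data.Sum using (inj₁; inj₂)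
open import Data.Empty using (⊥-elim)
open import Function using (_∘_)
open import Relation.Nullary using (¬_; Dec; yes; no)
open import Relation.Binary.PropositionalEquality
  using (_≡_; refl; sym; trans; cong; cong₂; _≗_; module ≡-Reasoning)

private
  variable
    t u a b c d e a' b' c' : ℕ

-- The gaps b − a and b' − a' are equal (stated without subtraction in
-- `exact`), or both are at least t in the same direction.
data GapEq (t a b a' b' : ℕ) : Set where
  far<  : a + t ≤ b → a' + t ≤ b' → GapEq t a b a' b'
  far>  : b + t ≤ a → b' + t ≤ a' → GapEq t a b a' b'
  exact : a + b' ≡ a' + b → GapEq t a b a' b'

gap⇒< : 1 ≤ t → a + t ≤ b → a < b
gap⇒< {a = a} t≥1 a+t≤b = <-≤-trans (m<m+n a t≥1) a+t≤b

GapEq-swap : GapEq t a b a' b' → GapEq t a' b' a b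
GapEq-swap (far< p p') = far< p' p
GapEq-swap (far> p p') = far> p' p
GapEq-swap (exact eq)  = exact (sym eq)

GapEq-reverse : GapEq t a b a' b' → GapEq t b a b' a'
GapEq-reverse (far< p p') = far> p p'
GapEq-reverse (far> p p') = far< p p'
GapEq-reverse {a = a} {b} {a'} {b'} (exact eq) =
  exact (trans (+-comm b a') (trans (sym eq) (+-comm a b')))

GapEq-mono : t ≤ u → GapEq u a b a' b' → GapEq t a b a' b'
GapEq-mono {a = a} {a' = a'} t≤u (far< p p') =
  far< (≤-trans (+-monoʳ-≤ a t≤u) p) (≤-trans (+-monoʳ-≤ a' t≤u) p')
GapEq-mono {b = b} {b' = b'} t≤u (far> p p') =
  far> (≤-trans (+-monoʳ-≤ b t≤u) p) (≤-trans (+-monoʳ-≤ b' t≤u) p')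
GapEq-mono t≤u (exact eq) = exact eq

GapEq-< : 1 ≤ t → a < b → GapEq t a b a' b' → a' < b'
GapEq-< t≥1 a<b (far< _ p') = gap⇒< t≥1 p'
GapEq-< t≥1 a<b (far> p _)  = ⊥-elim (<-asym a<b (gap⇒< t≥1 p))
GapEq-< {a = a} {b} {a'} {b'} t≥1 a<b (exact eq) = +-cancelʳ-< b a' b' (begin-strict
  a' + b ≡⟨ sym eq ⟩
  a + b' <⟨ +-monoˡ-< b' a<b ⟩
  b + b' ≡⟨ +-comm b b' ⟩
  b' + b ∎)
  where open ≤-Reasoning

GapEq-≡ : 1 ≤ t → a ≡ b → GapEq t a b a' b' → a' ≡ b'
GapEq-≡ t≥1 refl (far< p _) = ⊥-elim (<-irrefl refl (gap⇒< t≥1 p))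
GapEq-≡ t≥1 refl (far> p _) = ⊥-elim (<-irrefl refl (gap⇒< t≥1 p))
GapEq-≡ {a = a} {a' = a'} {b'} t≥1 refl (exact eq) =
  +-cancelˡ-≡ a a' b' (trans (+-comm a a') (sym eq))

GapEq-≤ : 1 ≤ t → a ≤ b → GapEq t a b a' b' → a' ≤ b'
GapEq-≤ t≥1 a≤b g with m≤n⇒m<n∨m≡n a≤b
... | inj₁ a<b = <⇒≤ (GapEq-< t≥1 a<b g)
... | inj₂ a≡b = ≤-reflexive (GapEq-≡ t≥1 a≡b g)

exact-trans : a + b' ≡ a' + b → b + c' ≡ b' + c → a + c' ≡ a' + c
exact-trans {a} {b'} {a'} {b} {c'} {c} eq eq' = +-cancelʳ-≡ (b + b') (a + c') (a' + c) (begin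
  (a + c') + (b + b') ≡⟨ interchange a c' b b' ⟩
  (a + b') + (b + c') ≡⟨ cong₂ _+_ eq eq' ⟩
  (a' + b) + (b' + c) ≡⟨ regroup a' b b' c ⟩
  (a' + c) + (b + b') ∎)
  where
  open ≡-Reasoning
  interchange : ∀ w x y z → (w + x) + (y + z) ≡ (w + z) + (y + x)
  interchange = solve-∀
  regroup : ∀ w x y z → (w + x) + (y + z) ≡ (w + z) + (x + y)
  regroup = solve-∀

GapEq-trans : 1 ≤ t → a ≤ b → b ≤ c →
              GapEq t a b a' b' → GapEq t b c b' c' → GapEq t a c a' c'
GapEq-trans t≥1 a≤b b≤c (far< p p') g = far< (≤-trans p b≤c) (≤-trans p' (GapEq-≤ t≥1 b≤c g))
GapEq-trans t≥1 a≤b b≤c (far> p _) g = ⊥-elim (<⇒≱ (gap⇒< t≥1 p) a≤b)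
GapEq-trans {t} t≥1 a≤b b≤c g@(exact _) (far< p p') =
  far< (≤-trans (+-monoˡ-≤ t a≤b) p) (≤-trans (+-monoˡ-≤ t (GapEq-≤ t≥1 a≤b g)) p')
GapEq-trans t≥1 a≤b b≤c (exact _) (far> p _) = ⊥-elim (<⇒≱ (gap⇒< t≥1 p) b≤c)
GapEq-trans {a = a} {b} {c} {a'} {b'} {c'} t≥1 a≤b b≤c (exact eq) (exact eq') =
  exact (exact-trans {a = a} {b'} {a'} {b} {c'} {c} eq eq')

n≤2*n : ∀ n → n ≤ 2 * n
n≤2*n n = m≤m+n n (n + 0)

+-2*-assoc : ∀ x t → x + t + t ≡ x + 2 * t
+-2*-assoc = solve-∀

GapEq-offset : GapEq t a (a + d) a' (a' + d)
GapEq-offset {a = a} {d} {a'} = exact (swap a a' d)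
  where
  swap : ∀ x y z → x + (y + z) ≡ y + (x + z)
  swap = solve-∀

GapEq-split-exact : a + c' ≡ a' + ((a + d) + e) →
                    GapEq t a (a + d) a' (a' + d) × GapEq t (a + d) ((a + d) + e) (a' + d) c'
GapEq-split-exact {a} {c'} {a'} {d} {e} eq = GapEq-offset , exact (begin
  (a + d) + c'             ≡⟨ pull a d c' ⟩
  d + (a + c')             ≡⟨ cong (d +_) eq ⟩
  d + (a' + ((a + d) + e)) ≡⟨ push d a' ((a + d) + e) ⟩
  (a' + d) + ((a + d) + e) ∎)
  where
  open ≡-Reasoning
  pull : ∀ x y z → (x + y) + z ≡ y + (x + z)
  pull = solve-∀
  push : ∀ x y z → x + (y + z) ≡ (y + x) + z
  push = solve-∀

+-slack-≤ : ∀ {x y} → d ≤ t → x + 2 * t ≤ y → (x + d) + t ≤ y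
+-slack-≤ {d} {t} {x} d≤t x+2t≤y =
  ≤-trans (+-monoˡ-≤ t (+-monoʳ-≤ x d≤t)) (≤-trans (≤-reflexive (+-2*-assoc x t)) x+2t≤y)

-- The new point is placed at distance d from a in the second order if it is
-- near a, at distance e from c' if it is near c, and at distance t from a'
-- otherwise; the room 2 t between a' and c' makes each choice fit.
GapEq-split-far : a + 2 * t ≤ (a + d) + e → a' + 2 * t ≤ c' →
                  ∃[ b' ] GapEq t a (a + d) a' b' × GapEq t (a + d) ((a + d) + e) b' c'
GapEq-split-far {a} {t} {d} {e} {a'} {c'} p p' with d ≤? t | e ≤? t
... | yes d≤t | _ = a' + d , GapEq-offset , far< (+-slack-≤ d≤t p) (+-slack-≤ d≤t p')
... | no d≰t | no e≰t = a' + t , far< (+-monoʳ-≤ a (≰⇒≥ d≰t)) ≤-refl ,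
                        far< (+-monoʳ-≤ (a + d) (≰⇒≥ e≰t)) (≤-trans (≤-reflexive (+-2*-assoc a' t)) p')
... | no d≰t | yes e≤t with m≤n⇒∃[o]m+o≡n
                          (≤-trans (≤-trans (m≤n+m e a') (m≤m+n (a' + e) t)) (+-slack-≤ e≤t p'))
...   | o , refl = o , far< (+-monoʳ-≤ a (≰⇒≥ d≰t)) a'+t≤o , exact (shift (a + d) e o)
  where
  shift : ∀ x y z → x + (y + z) ≡ z + (x + y)
  shift = solve-∀
  a'+t≤o : a' + t ≤ o
  a'+t≤o = +-cancelʳ-≤ e (a' + t) o (begin
    a' + t + e  ≤⟨ +-monoʳ-≤ (a' + t) e≤t ⟩
    a' + t + t  ≡⟨ +-2*-assoc a' t ⟩
    a' + 2 * t  ≤⟨ p' ⟩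
    e + o       ≡⟨ +-comm e o ⟩
    o + e       ∎)
    where open ≤-Reasoning

GapEq-split : 1 ≤ t → a ≤ b → b ≤ c → GapEq (2 * t) a c a' c' →
              ∃[ b' ] GapEq t a b a' b' × GapEq t b c b' c'
GapEq-split t≥1 a≤b b≤c g with m≤n⇒∃[o]m+o≡n a≤b | m≤n⇒∃[o]m+o≡n b≤c
GapEq-split t≥1 a≤b b≤c (far< p p') | d , refl | e , refl = GapEq-split-far p p'
GapEq-split {t} t≥1 a≤b b≤c (far> p _) | d , refl | e , refl =
  ⊥-elim (<⇒≱ (gap⇒< (≤-trans t≥1 (n≤2*n t)) p) (≤-trans a≤b b≤c))
GapEq-split t≥1 a≤b b≤c (exact eq) | d , refl | e , refl = _ , GapEq-split-exact eq

Similar : {A : Set} → ℕ → (A → ℕ) → (A → ℕ) → Set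
Similar t f f' = ∀ c d → GapEq t (f c) (f d) (f' c) (f' d)

Similar-resp : {A : Set} {f g f' g' : A → ℕ} → f ≗ g → f' ≗ g' → Similar t g g' → Similar t f f'
Similar-resp f≗g f'≗g' s c d rewrite f≗g c | f≗g d | f'≗g' c | f'≗g' d = s c d

module _ {A : Set} (f : A → ℕ) (xs : List A) where

  greatestBelow : (lo : A) → f lo ≤ a →
                  Σ A λ b → f b ≤ a × (∀ {c} → c ∈ xs → f c ≤ a → f c ≤ f b)
  greatestBelow {a} lo lo≤a =
    argmax f lo below , argmax-all f lo≤a (all-filter below? xs) ,
    λ c∈xs c≤a → lookup (f[xs]≤f[argmax] lo below) (∈-filter⁺ below? c∈xs c≤a)
    where
    below? : ∀ c → Dec (f c ≤ a)
    below? c = f c ≤? a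
    below : List A
    below = filter below? xs

  leastAbove : (hi : A) → a ≤ f hi →
               Σ A λ b → a ≤ f b × (∀ {c} → c ∈ xs → a ≤ f c → f b ≤ f c)
  leastAbove {a} hi a≤hi =
    argmin f hi above , argmin-all f a≤hi (all-filter above? xs) ,
    λ c∈xs a≤c → lookup (f[argmin]≤f[xs] hi above) (∈-filter⁺ above? c∈xs a≤c)
    where
    above? : ∀ c → Dec (a ≤ f c)
    above? c = a ≤? f c
    above : List A
    above = filter above? xs

_▹_ : {A : Set} → (A → ℕ) → ℕ → Maybe A → ℕ
(f ▹ a) nothing  = a
(f ▹ a) (just c) = f c

-- Duplicator's answer a' to a new point a is placed, by GapEq-split, between
-- the answers to the nearest old points below and above a.
Similar-extend : {A : Set} {f f' : A → ℕ} (xs : List A) → (∀ c → c ∈ xs) →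
                 1 ≤ t → Similar (2 * t) f f' →
                 (lo hi : A) → f lo ≤ a → a ≤ f hi → ∃[ a' ] Similar t (f ▹ a) (f' ▹ a')
Similar-extend {t} {a} {f = f} {f'} xs enum t≥1 s lo hi lo≤a a≤hi
  with greatestBelow f xs lo lo≤a | leastAbove f xs hi a≤hi
... | l , l≤a , l-max | h , a≤h , h-min with GapEq-split t≥1 l≤a a≤h (s l h)
... | a' , l~a , a~h = a' , similar
  where
  toNew : ∀ c → GapEq t (f c) a (f' c) a'
  toNew c with f c ≤? a
  ... | yes c≤a = GapEq-trans t≥1 (l-max (enum c) c≤a) l≤a (GapEq-mono (n≤2*n t) (s c l)) l~a
  ... | no c≰a = GapEq-reverse
    (GapEq-trans t≥1 a≤h (h-min (enum c) (<⇒≤ (≰⇒> c≰a))) a~h (GapEq-mono (n≤2*n t) (s h c)))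
  similar : Similar t (f ▹ a) (f' ▹ a')
  similar nothing  nothing  = exact (+-comm a a')
  similar nothing  (just d) = GapEq-reverse (toNew d)
  similar (just c) nothing  = toNew c
  similar (just c) (just d) = GapEq-mono (n≤2*n t) (s c d)

-- Pebbles are shifted one position to the right so that the two ends of a
-- word of length m sit at 0 and m + 1.
data Point (k : ℕ) : Set where
  start end : Point k
  var       : Fin k → Point k

points : (k : ℕ) → List (Point k)
points k = start ∷ end ∷ map var (allFin k)

∈-points : ∀ {k} (c : Point k) → c ∈ points k
∈-points start   = here refl
∈-points end     = there (here refl)
∈-points (var y) = there (there (∈-map⁺ var (∈-allFin y)))

pos : ∀ {k} → ℕ → Assignment k → Point k → ℕ
pos m α start   = 0
pos m α end     = suc m
pos m α (var y) = suc (α y)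

relabel : ∀ {k} → Fin k → Point k → Maybe (Point k)
relabel x (var y) with x ≟ᶠ y
... | yes _ = nothing
... | no _  = just (var y)
relabel x c = just c

pos-update : ∀ {k} m (α : Assignment k) x p → pos m (α [ x ↦ p ]) ≗ (pos m α ▹ suc p) ∘ relabel x
pos-update m α x p start = refl
pos-update m α x p end   = refl
pos-update m α x p (var y) with x ≟ᶠ y
... | yes _ = refl
... | no _  = refl

Similar-update : ∀ {k m m'} {α β : Assignment k} → 1 ≤ t →
                 Similar (2 * t) (pos m α) (pos m' β) → ∀ x p → p < m →
                 ∃[ p' ] p' < m' × Similar t (pos m (α [ x ↦ p ])) (pos m' (β [ x ↦ p' ]))
Similar-update {t} {k} {m} {m'} {α} {β} t≥1 s x p p<m =
  answer (Similar-extend (points k) ∈-points t≥1 s start end z≤n (s≤s (<⇒≤ p<m)))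
  where
  answer : ∃[ a' ] Similar t (pos m α ▹ suc p) (pos m' β ▹ a') →
           ∃[ p' ] p' < m' × Similar t (pos m (α [ x ↦ p ])) (pos m' (β [ x ↦ p' ]))
  answer (zero , s⁺) = ⊥-elim (n≮0 (GapEq-< t≥1 (s≤s z≤n) (s⁺ (just start) nothing)))
  answer (suc p' , s⁺) = p' , ≤-pred (GapEq-< t≥1 (s≤s p<m) (s⁺ nothing (just end))) ,
    Similar-resp (pos-update m α x p) (pos-update m' β x p') (λ c d → s⁺ (relabel x c) (relabel x d))

Similar-initial : ∀ {k m m'} → t ≤ m → t ≤ m' →
                  Similar t (pos {k} m (λ _ → 0)) (pos m' (λ _ → 0))
Similar-initial t≤m t≤m' start   start   = exact refl
Similar-initial t≤m t≤m' start   end     = far< (m≤n⇒m≤1+n t≤m) (m≤n⇒m≤1+n t≤m')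
Similar-initial t≤m t≤m' start   (var _) = exact refl
Similar-initial t≤m t≤m' end     start   = far> (m≤n⇒m≤1+n t≤m) (m≤n⇒m≤1+n t≤m')
Similar-initial {m = m} {m'} t≤m t≤m' end end = exact (+-comm (suc m) (suc m'))
Similar-initial t≤m t≤m' end     (var _) = far> (s≤s t≤m) (s≤s t≤m')
Similar-initial t≤m t≤m' (var _) start   = exact refl
Similar-initial t≤m t≤m' (var _) end     = far< (s≤s t≤m) (s≤s t≤m')
Similar-initial t≤m t≤m' (var _) (var _) = exact refl

Fin1-unique : (i j : Fin 1) → i ≡ j
Fin1-unique zero zero = refl

Sat-transfer : ∀ {k} q (φ : Formula 1 k) → qr φ ≤ q →
               ∀ {w w' : Word 1} {α β} → Similar (2 ^ q) (pos (length w) α) (pos (length w') β) →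
               Sat w α φ → Sat w' β φ
Sat-transfer q (x ≐ y) _ s eq = suc-injective (GapEq-≡ (m^n>0 2 q) (cong suc eq) (s (var x) (var y)))
Sat-transfer q (x ≺ y) _ s x<y = ≤-pred (GapEq-< (m^n>0 2 q) (s≤s x<y) (s (var x) (var y)))
Sat-transfer q (Rel i x) _ s (x<m , _) =
  ≤-pred (GapEq-< (m^n>0 2 q) (s≤s x<m) (s (var x) end)) , Fin1-unique _ _
Sat-transfer q (¬ᶠ φ) qr≤q s ¬sat sat' = ¬sat (Sat-transfer q φ qr≤q (λ c d → GapEq-swap (s c d)) sat')
Sat-transfer q (φ ∧ᶠ ψ) qr≤q s (sat₁ , sat₂) =
  Sat-transfer q φ (m⊔n≤o⇒m≤o _ _ qr≤q) s sat₁ , Sat-transfer q ψ (m⊔n≤o⇒n≤o _ _ qr≤q) s sat₂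
Sat-transfer q (φ ∨ᶠ ψ) qr≤q s (inj₁ sat) = inj₁ (Sat-transfer q φ (m⊔n≤o⇒m≤o _ _ qr≤q) s sat)
Sat-transfer q (φ ∨ᶠ ψ) qr≤q s (inj₂ sat) = inj₂ (Sat-transfer q ψ (m⊔n≤o⇒n≤o _ _ qr≤q) s sat)
Sat-transfer (suc q) (∃ᶠ x φ) (s≤s qr≤q) s (p , p<m , sat) =
  let p' , p'<m' , s' = Similar-update (m^n>0 2 q) s x p p<m
  in p' , p'<m' , Sat-transfer q φ qr≤q s' sat
Sat-transfer (suc q) (∀ᶠ x φ) (s≤s qr≤q) s sat p' p'<m' =
  let p , p<m , s' = Similar-update (m^n>0 2 q) (λ c d → GapEq-swap (s c d)) x p' p'<m'
  in Sat-transfer q φ qr≤q (λ c d → GapEq-swap (s' c d)) (sat p p<m)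

long-words-indistinguishable : ∀ {k q} (φ : Formula 1 k) → qr φ ≤ q → {w w' : Word 1} →
                               2 ^ q ≤ length w → 2 ^ q ≤ length w' → w ⊨ φ → w' ⊨ φ
long-words-indistinguishable {q = q} φ qr≤q 2^q≤m 2^q≤m' =
  Sat-transfer q φ qr≤q (Similar-initial 2^q≤m 2^q≤m')

other : Fin 2 → Fin 2
other zero       = suc zero
other (suc zero) = zero

other≢ : ∀ x → ¬ (other x ≡ x)
other≢ zero ()
other≢ (suc zero) ()

update-same : ∀ {k} (α : Assignment k) x p → (α [ x ↦ p ]) x ≡ p
update-same α x p with x ≟ᶠ x
... | yes _ = refl
... | no x≢x = ⊥-elim (x≢x refl)

update-other : ∀ {k} (α : Assignment k) x y p → ¬ (x ≡ y) → (α [ x ↦ p ]) y ≡ α y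
update-other α x y p x≢y with x ≟ᶠ y
... | yes x≡y = ⊥-elim (x≢y x≡y)
... | no _    = refl

atLeastBelow : ℕ → Fin 2 → Formula 1 2
atLeastBelow zero    x = x ≐ x
atLeastBelow (suc j) x = ∃ᶠ (other x) ((other x ≺ x) ∧ᶠ atLeastBelow j (other x))

atLeastBelow-sound : ∀ {w : Word 1} j α x → Sat w α (atLeastBelow j x) → j ≤ α x
atLeastBelow-sound zero    α x _ = z≤n
atLeastBelow-sound (suc j) α x (p , _ , below , sat) = begin
  suc j                       ≤⟨ s≤s (atLeastBelow-sound j (α [ other x ↦ p ]) (other x) sat) ⟩
  suc ((α [ other x ↦ p ]) (other x)) ≤⟨ below ⟩
  (α [ other x ↦ p ]) x       ≡⟨ update-other α (other x) x p (other≢ x) ⟩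
  α x                         ∎
  where open ≤-Reasoning

atLeastBelow-complete : ∀ {w : Word 1} j α x → α x ≤ length w → j ≤ α x → Sat w α (atLeastBelow j x)
atLeastBelow-complete zero α x _ _ = refl
atLeastBelow-complete {w} (suc j) α x x≤m j<x with α x in αx≡
... | suc p = p , x≤m , below , atLeastBelow-complete j α' (other x) p≤m j≤p
  where
  α' : Assignment 2
  α' = α [ other x ↦ p ]
  new : α' (other x) ≡ p
  new = update-same α (other x) p
  below : α' (other x) < α' x
  below rewrite new | update-other α (other x) x p (other≢ x) | αx≡ = ≤-refl
  p≤m : α' (other x) ≤ length w
  p≤m rewrite new = <⇒≤ x≤m
  j≤p : j ≤ α' (other x)
  j≤p rewrite new = ≤-pred j<x

atLeastBelow-free : ∀ j x z → FreeIn {1} z (atLeastBelow j x) → z ≡ x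
atLeastBelow-free zero    x z f≐ˡ = refl
atLeastBelow-free zero    x z f≐ʳ = refl
atLeastBelow-free (suc j) x z (f∃ x≢z (f∧ˡ f≺ˡ)) = ⊥-elim (x≢z refl)
atLeastBelow-free (suc j) x z (f∃ x≢z (f∧ˡ f≺ʳ)) = refl
atLeastBelow-free (suc j) x z (f∃ x≢z (f∧ʳ free)) = ⊥-elim (x≢z (sym (atLeastBelow-free j (other x) z free)))

qr-atLeastBelow : ∀ j x → qr (atLeastBelow j x) ≡ j
qr-atLeastBelow zero    x = refl
qr-atLeastBelow (suc j) x = cong suc (qr-atLeastBelow j (other x))

longerThan : ℕ → Formula 1 2
longerThan j = ∃ᶠ zero (atLeastBelow j zero)

longerThan-sentence : ∀ j → Sentence (longerThan j)
longerThan-sentence j z (f∃ zero≢z free) = zero≢z (sym (atLeastBelow-free j zero z free))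

longerThan-expresses : ∀ j → Expresses (longerThan j) (λ w → j < length w)
longerThan-expresses j w = complete , sound
  where
  init : Assignment 2
  init _ = 0
  complete : j < length w → w ⊨ longerThan j
  complete j<m = j , j<m , atLeastBelow-complete j (init [ zero ↦ j ]) zero
    (≤-trans (≤-reflexive (update-same init zero j)) (<⇒≤ j<m))
    (≤-reflexive (sym (update-same init zero j)))
  sound : w ⊨ longerThan j → j < length w
  sound (p , p<m , sat) =
    ≤-<-trans (≤-trans (atLeastBelow-sound j _ zero sat) (≤-reflexive (update-same init zero p))) p<m

longerThan-expressible : ∀ j → ExpressibleIn 1 2 (suc j) (λ w → j < length w)
longerThan-expressible j =
  longerThan j , (longerThan-sentence j , ≤-reflexive (cong suc (qr-atLeastBelow j zero))) ,
  longerThan-expresses j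

ExpressibleIn-mono : ∀ {r k q q'} {P : Word r → Set} → q ≤ q' → ExpressibleIn r k q P → ExpressibleIn r k q' P
ExpressibleIn-mono q≤q' (φ , (sentence , qr≤q) , expresses) = φ , (sentence , ≤-trans qr≤q q≤q') , expresses

longerThan-inexpressible : ∀ {k} q → ¬ ExpressibleIn 1 k q (λ w → 2 ^ q < length w)
longerThan-inexpressible q (φ , (_ , qr≤q) , expresses) = <-irrefl (sym |short|) short-is-long
  where
  short long : Word 1
  short = replicate (2 ^ q) zero
  long  = zero ∷ short
  |short| : length short ≡ 2 ^ q
  |short| = length-replicate (2 ^ q)
  short-is-long : 2 ^ q < length short
  short-is-long = proj₂ (expresses short)
    (long-words-indistinguishable φ qr≤q (≤-trans (≤-reflexive (sym |short|)) (n≤1+n _))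
       (≤-reflexive (sym |short|)) (proj₁ (expresses long) (s≤s (≤-reflexive (sym |short|)))))

proposition3p2p3 : (n : ℕ) →
    Σ ℕ (λ r → Σ (Word r → Set) (λ P →
    ExpressibleIn r 2 (2 ^ n + 2) P ×
    ((k : ℕ) → 1 ≤ k → ¬ ExpressibleIn r k n P)))
proposition3p2p3 n =
  1 , (λ w → 2 ^ n < length w) ,
  ExpressibleIn-mono (≤-trans (n≤1+n _) (≤-reflexive (+-comm 2 (2 ^ n)))) (longerThan-expressible (2 ^ n)) ,
  λ k _ → longerThan-inexpressible n
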